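{- Let $\mathcal{C}$ be a class of colorings that has the refinement property. Then for every hypergraph $H$ with $n$ vertices, $\mathrm{ch}_{\mathcal{C}}(H)\le\chi_{\mathcal{C}}(H)\cdot\ln n+1$.
   Context: A class of colorings $\mathcal{C}$ specifies, for each hypergraph $H=(V,\mathcal{E})$, which colorings $C\colon V\to\mathbb{Z}_{>0}$ are $\mathcal{C}$-colorings of $H$. A coloring $C'$ is a refinement of $C$ if $C(x)\ne C(y)$ implies $C'(x)\ne C'(y)$. $\mathcal{C}$ has the refinement property if every refinement of a $\mathcal{C}$-coloring of $H$ is also a $\mathcal{C}$-coloring of $H$. $\chi_{\mathcal{C}}(H)$ is the minimum number of colors in a $\mathcal{C}$-coloring of $H$, and $\mathrm{ch}_{\mathcal{C}}(H)$ is the minimum $k$ such that for every family $\{L_v\}_{v\in V}$ of sets of positive integers with $|L_v|\ge k$ there is a $\mathcal{C}$-coloring $C$ of $H$ with $C(v)\in L_v$ for all $v$. -}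

module Defs where

open import Data.Nat using (ℕ; zero; suc; _+_; _*_; _^_; _≤_; _<_; _!)

open import Data.Fin using (Fin)
open import Data.Fin.Subset using (Subset)
open import Data.List using (List; length)
open import Data.List.Membership.Propositional using (_∈_)
open import Data.List.Relation.Unary.Unique.Propositional using (Unique)
open import Data.Product using (Σ; _×_; ∃)
open import Relation.Binary.PropositionalEquality using (_≢_)

record Hypergraph (n : ℕ) : Set₁ where
  field
    IsEdge : Subset n → Set

-- A (vertex) coloring: a map from vertices to ℕ; only maps with all
-- values positive count as colorings (colors are positive integers).
Coloring : ℕ → Set
Coloring n = Fin n → ℕ

Positive : ∀ {n} → Coloring n → Set
Positive {n} c = (v : Fin n) → 0 < c v

ColoringClass : Set₁
ColoringClass = ∀ {n} → Hypergraph n → Coloring n → Set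

IsCColoring : ColoringClass → ∀ {n} → Hypergraph n → Coloring n → Set
IsCColoring 𝒞 H c = Positive c × 𝒞 H c

IsRefinement : ∀ {n} → Coloring n → Coloring n → Set
IsRefinement {n} c c' = (x y : Fin n) → c x ≢ c y → c' x ≢ c' y

RefinementProperty : ColoringClass → Set₁
RefinementProperty 𝒞 =
  ∀ {n} (H : Hypergraph n) (c c' : Coloring n) →
  IsCColoring 𝒞 H c → Positive c' → IsRefinement c c' → IsCColoring 𝒞 H c'

UsesAtMostColors : ∀ {n} → Coloring n → ℕ → Set
UsesAtMostColors {n} c k =
  Σ (List ℕ) λ cs → length cs ≤ k × ((v : Fin n) → c v ∈ cs)

ChromaticAtMost : ColoringClass → ∀ {n} → Hypergraph n → ℕ → Set
ChromaticAtMost 𝒞 H k = ∃ λ c → IsCColoring 𝒞 H c × UsesAtMostColors c k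

ListColorable : ColoringClass → ∀ {n} → Hypergraph n → ℕ → Set
ListColorable 𝒞 {n} H m =
  (L : Fin n → List ℕ) →
  ((v : Fin n) → Unique (L v)) →
  ((v : Fin n) → m ≤ length (L v)) →
  ((v : Fin n) (x : ℕ) → x ∈ L v → 0 < x) →
  ∃ λ c → IsCColoring 𝒞 H c × ((v : Fin n) → c v ∈ L v)

-- expScaled a K = K! * Σ_{j=0}^{K} a^j / j!   (an integer)
expScaled : ℕ → ℕ → ℕ
expScaled a zero = 1
expScaled a (suc K) = suc K * expScaled a K + a ^ suc K

-- e^a ≤ N, i.e. a ≤ ln N: every partial sum of the exponential series
-- Σ_j a^j/j! is at most N (e^a is the supremum of these partial sums).
ExpLe : ℕ → ℕ → Set
ExpLe a N = (K : ℕ) → expScaled a K ≤ N * (K !)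

-- Let c be a 𝒞-coloring with k = m + 1 colors and let a be the last exponent with
-- (k/m)^a ≤ n. Since ln (k/m) ≥ 1/k this gives a ≤ k ln n; in integers, e^a ≤ n^k follows
-- by comparing ∑ a^j/j! termwise with the negative binomial series
-- ∑_j C(ak + j − 1, j) k^(−j) = (k/m)^(ak).
-- Given lists of size a + 1, send every list entry to a uniformly random color of c. A
-- vertex v is missed (no entry of L v goes to c v) with probability (m/k)^(a+1), and
-- n (m/k)^(a+1) < 1 by the choice of a, so some map f misses no vertex; it is found by the
-- method of conditional expectations. Choosing for each v an entry of L v that f sends to
-- c v gives a coloring c′ with c = f ∘ c′: a refinement of c, hence a 𝒞-coloring from the lists.
module Submission where

open import Defs
open import Data.Bool using (true; false; if_then_else_)
open import Data.Fin using (Fin; zero)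
open import Data.List using (List; []; _∷_; _++_; length; map; filter; concat; tabulate; replicate; deduplicate)
open import Data.List.Extrema.Nat using (argmin; argmin-all; f[argmin]≤f[⊤]; f[argmin]≤f[xs])
open import Data.List.Membership.Propositional using (_∈_)
open import Data.List.Membership.Propositional.Properties
  using (∈-∃++; ∈-++⁻; ∈-++⁺ˡ; ∈-++⁺ʳ; ∈-filter⁺; ∈-tabulate⁺; ∈-concat⁺′; ∈-deduplicate⁺)
open import Data.List.Properties using (length-++; length-replicate; length-tabulate; map-cong)
open import Data.List.Relation.Unary.All as All using (All; []; _∷_)
open import Data.List.Relation.Unary.All.Properties as All using ()
open import Data.List.Relation.Unary.Any using (here; there)
open import Data.List.Relation.Unary.Unique.Propositional using (Unique; _∷_)
open import Data.Nat
open import Data.Nat.ListAction using (sum)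
open import Data.Nat.Properties
open import Data.Nat.Tactic.RingSolver using (solve-∀)
open import Data.Product using (Σ; ∃; _×_; _,_; proj₁; proj₂)
open import Data.Sum using (inj₁; inj₂)
open import Function using (_∘_)
open import Relation.Nullary using (¬_; yes; no; does; _×-dec_; contradiction)
open import Relation.Nullary.Decidable using (dec-true; dec-false)
open import Relation.Unary using (Pred; Decidable)
open import Relation.Unary.Properties using (∁?)
open import Relation.Binary.PropositionalEquality
open import Data.List.Membership.DecPropositional _≟_ using (_∈?_)
open import Data.List.Relation.Unary.Unique.DecPropositional.Properties _≟_ using (deduplicate-!)
import Algebra.Properties.CommutativeSemigroup as CommutativeSemigroupProperties

open CommutativeSemigroupProperties *-commutativeSemigroup using (interchange; x∙yz≈y∙xz; xy∙z≈xz∙y)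
open CommutativeSemigroupProperties +-commutativeSemigroup
  using () renaming (interchange to +-interchange; x∙yz≈y∙xz to +-exchange)

private
  variable
    A B : Set

^-distribʳ-* : ∀ m n o → (m * n) ^ o ≡ m ^ o * n ^ o
^-distribʳ-* m n zero    = refl
^-distribʳ-* m n (suc o) = begin
  m * n * (m * n) ^ o      ≡⟨ cong (m * n *_) (^-distribʳ-* m n o) ⟩
  m * n * (m ^ o * n ^ o)  ≡⟨ interchange m n (m ^ o) (n ^ o) ⟩
  m * m ^ o * (n * n ^ o)  ∎
  where open ≡-Reasoning

^-ratio-antitone : ∀ {m k j c} → m ≤ k → j ≤ c → m ^ c * k ^ j ≤ m ^ j * k ^ c
^-ratio-antitone {m} {k} {c = c} m≤k z≤n = begin
  m ^ c * 1  ≡⟨ *-identityʳ (m ^ c) ⟩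
  m ^ c      ≤⟨ ^-monoˡ-≤ c m≤k ⟩
  k ^ c      ≡⟨ *-identityˡ (k ^ c) ⟨
  1 * k ^ c  ∎
  where open ≤-Reasoning
^-ratio-antitone {m} {k} {suc j} {suc c} m≤k (s≤s j≤c) = begin
  m * m ^ c * (k * k ^ j)  ≡⟨ interchange m (m ^ c) k (k ^ j) ⟩
  m * k * (m ^ c * k ^ j)  ≤⟨ *-monoʳ-≤ (m * k) (^-ratio-antitone m≤k j≤c) ⟩
  m * k * (m ^ j * k ^ c)  ≡⟨ interchange m k (m ^ j) (k ^ c) ⟩
  m * m ^ j * (k * k ^ c)  ∎
  where open ≤-Reasoning

rising : ℕ → ℕ → ℕ
rising M zero    = 1
rising M (suc j) = M * rising (suc M) j

rising-suc : ∀ M j → rising M (suc j) ≡ rising M j * (M + j)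
rising-suc M zero    = identity M
  where
  identity : ∀ M → M * 1 ≡ 1 * (M + 0)
  identity = solve-∀
rising-suc M (suc j) = begin
  M * rising (suc M) (suc j)          ≡⟨ cong (M *_) (rising-suc (suc M) j) ⟩
  M * (rising (suc M) j * (suc M + j)) ≡⟨ regroup M (rising (suc M) j) j ⟩
  M * rising (suc M) j * (M + suc j)  ∎
  where
  open ≡-Reasoning
  regroup : ∀ M r j → M * (r * (suc M + j)) ≡ M * r * (M + suc j)
  regroup = solve-∀

rising-pascal : ∀ M j → rising (suc M) (suc j) ≡ rising M (suc j) + suc j * rising (suc M) j
rising-pascal M j = begin
  rising (suc M) (suc j)               ≡⟨ rising-suc (suc M) j ⟩
  rising (suc M) j * (suc M + j)       ≡⟨ split M (rising (suc M) j) j ⟩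
  M * rising (suc M) j + suc j * rising (suc M) j ∎
  where
  open ≡-Reasoning
  split : ∀ M r j → r * (suc M + j) ≡ M * r + suc j * r
  split = solve-∀

^≤rising : ∀ {M N} → M ≤ N → ∀ j → M ^ j ≤ rising N j
^≤rising M≤N zero    = ≤-refl
^≤rising M≤N (suc j) = *-mono-≤ M≤N (^≤rising (m≤n⇒m≤1+n M≤N) j)

-- With k = m + 1, series M K = K! k^K ∑_{j ≤ K} rising M j / (j! k^j) is a scaled
-- partial sum of the negative binomial series ∑_j C(M + j − 1, j) k^(−j) = (k/m)^M.
module NegativeBinomial (m : ℕ) where

  k : ℕ
  k = suc m

  series : ℕ → ℕ → ℕ
  series M zero    = 1
  series M (suc K) = suc K * k * series M K + rising M (suc K)

  -- k times series-pascal M (K − 1), rearranged so that it also holds at K = 0.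
  series-pascal′ : ∀ M K →
    k * series (suc M) K + rising (suc M) K ≡ k * series M K + series (suc M) K
  series-pascal′ M zero    = refl
  series-pascal′ M (suc K) = begin
    k * (suc K * k * W₁ + R₁′) + R₁′
      ≡⟨ cong (λ r → k * (suc K * k * W₁ + r) + R₁′) (rising-pascal M K) ⟩
    k * (suc K * k * W₁ + (R₀′ + suc K * R₁)) + R₁′
      ≡⟨ expand k K W₁ R₀′ R₁ R₁′ ⟩
    k * suc K * (k * W₁ + R₁) + k * R₀′ + R₁′
      ≡⟨ cong (λ z → k * suc K * z + k * R₀′ + R₁′) (series-pascal′ M K) ⟩
    k * suc K * (k * W₀ + W₁) + k * R₀′ + R₁′
      ≡⟨ collect k K W₀ W₁ R₀′ R₁′ ⟩
    k * (suc K * k * W₀ + R₀′) + (suc K * k * W₁ + R₁′) ∎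
    where
    open ≡-Reasoning
    W₀ W₁ R₁ R₀′ R₁′ : ℕ
    W₀ = series M K
    W₁ = series (suc M) K
    R₁ = rising (suc M) K
    R₀′ = rising M (suc K)
    R₁′ = rising (suc M) (suc K)
    expand : ∀ k K w r s t →
      k * (suc K * k * w + (r + suc K * s)) + t ≡ k * suc K * (k * w + s) + k * r + t
    expand = solve-∀
    collect : ∀ k K v w r t →
      k * suc K * (k * v + w) + k * r + t ≡ k * (suc K * k * v + r) + (suc K * k * w + t)
    collect = solve-∀

  series-pascal : ∀ M K → series (suc M) (suc K) ≡ series M (suc K) + suc K * series (suc M) K
  series-pascal M K = begin
    suc K * k * W₁ + R₁′
      ≡⟨ cong (suc K * k * W₁ +_) (rising-pascal M K) ⟩
    suc K * k * W₁ + (R₀′ + suc K * R₁)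
      ≡⟨ expand K k W₁ R₀′ R₁ ⟩
    suc K * (k * W₁ + R₁) + R₀′
      ≡⟨ cong (λ z → suc K * z + R₀′) (series-pascal′ M K) ⟩
    suc K * (k * W₀ + W₁) + R₀′
      ≡⟨ collect K k W₀ W₁ R₀′ ⟩
    (suc K * k * W₀ + R₀′) + suc K * W₁ ∎
    where
    open ≡-Reasoning
    W₀ W₁ R₁ R₀′ R₁′ : ℕ
    W₀ = series M K
    W₁ = series (suc M) K
    R₁ = rising (suc M) K
    R₀′ = rising M (suc K)
    R₁′ = rising (suc M) (suc K)
    expand : ∀ K k w r s → suc K * k * w + (r + suc K * s) ≡ suc K * (k * w + s) + r
    expand = solve-∀
    collect : ∀ K k v w r → suc K * (k * v + w) + r ≡ (suc K * k * v + r) + suc K * w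
    collect = solve-∀

  series-zero : ∀ K → series 0 K ≡ K ! * k ^ K
  series-zero zero    = refl
  series-zero (suc K) = begin
    suc K * k * series 0 K + 0     ≡⟨ cong (λ z → suc K * k * z + 0) (series-zero K) ⟩
    suc K * k * (K ! * k ^ K) + 0  ≡⟨ regroup K k (K !) (k ^ K) ⟩
    suc K * K ! * (k * k ^ K)      ∎
    where
    open ≡-Reasoning
    regroup : ∀ K k f p → suc K * k * (f * p) + 0 ≡ suc K * f * (k * p)
    regroup = solve-∀

  series-bound : ∀ M K → m ^ M * series M K ≤ k ^ (M + K) * K !
  series-bound zero    K = ≤-reflexive (begin
    1 * series 0 K  ≡⟨ *-identityˡ _ ⟩
    series 0 K      ≡⟨ series-zero K ⟩
    K ! * k ^ K     ≡⟨ *-comm (K !) (k ^ K) ⟩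
    k ^ K * K !     ∎)
    where open ≡-Reasoning
  series-bound (suc M) zero    = begin
    m ^ suc M * 1        ≡⟨ *-identityʳ _ ⟩
    m ^ suc M            ≤⟨ ^-monoˡ-≤ (suc M) (n≤1+n m) ⟩
    k ^ suc M            ≡⟨ cong (k ^_) (sym (+-identityʳ (suc M))) ⟩
    k ^ (suc M + 0)      ≡⟨ *-identityʳ _ ⟨
    k ^ (suc M + 0) * 1  ∎
    where open ≤-Reasoning
  series-bound (suc M) (suc K) = begin
    m ^ suc M * series (suc M) (suc K)
      ≡⟨ cong (m ^ suc M *_) (series-pascal M K) ⟩
    m * m ^ M * (series M (suc K) + suc K * series (suc M) K)
      ≡⟨ distribute m (m ^ M) (series M (suc K)) K (series (suc M) K) ⟩
    m * (m ^ M * series M (suc K)) + suc K * (m ^ suc M * series (suc M) K)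
      ≤⟨ +-mono-≤ (*-monoʳ-≤ m (series-bound M (suc K)))
                  (*-monoʳ-≤ (suc K) (series-bound (suc M) K)) ⟩
    m * (k ^ (M + suc K) * (suc K) !) + suc K * (k ^ (suc M + K) * K !)
      ≡⟨ cong (λ e → m * (k ^ (M + suc K) * (suc K) !) + suc K * (k ^ e * K !)) (+-suc M K) ⟨
    m * (k ^ (M + suc K) * (suc K) !) + suc K * (k ^ (M + suc K) * K !)
      ≡⟨ collect m (k ^ (M + suc K)) K (K !) ⟩
    k ^ (suc M + suc K) * (suc K) ! ∎
    where
    open ≤-Reasoning
    distribute : ∀ m p w K v → m * p * (w + suc K * v) ≡ m * (p * w) + suc K * (m * p * v)
    distribute = solve-∀
    collect : ∀ m X K f → m * (X * (suc K * f)) + suc K * (X * f) ≡ suc m * X * (suc K * f)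
    collect = solve-∀

  expScaled≤series : ∀ a K → k ^ K * expScaled a K ≤ series (a * k) K
  expScaled≤series a zero    = ≤-refl
  expScaled≤series a (suc K) = begin
    k * k ^ K * (suc K * expScaled a K + a * a ^ K)
      ≡⟨ expand k (k ^ K) K (expScaled a K) a (a ^ K) ⟩
    suc K * k * (k ^ K * expScaled a K) + a * k * (a ^ K * k ^ K)
      ≡⟨ cong (λ z → suc K * k * (k ^ K * expScaled a K) + a * k * z) (^-distribʳ-* a k K) ⟨
    suc K * k * (k ^ K * expScaled a K) + (a * k) ^ suc K
      ≤⟨ +-mono-≤ (*-monoʳ-≤ (suc K * k) (expScaled≤series a K)) (^≤rising {a * k} ≤-refl (suc K)) ⟩
    suc K * k * series (a * k) K + rising (a * k) (suc K) ∎
    where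
    open ≤-Reasoning
    expand : ∀ k q K E a p → k * q * (suc K * E + a * p) ≡ suc K * k * (q * E) + a * k * (p * q)
    expand = solve-∀

expLe-from-ratio : ∀ m n a → suc m ^ a ≤ n * m ^ a → ExpLe a (n ^ suc m)
expLe-from-ratio m n a ratio K = *-cancelˡ-≤ (m ^ M) {{mᴹ≢0}} (begin
  m ^ M * expScaled a K  ≤⟨ *-cancelˡ-≤ (k ^ K) {{m^n≢0 k K}} scaled ⟩
  k ^ M * K !            ≤⟨ *-monoˡ-≤ (K !) kᴹ≤nᵏmᴹ ⟩
  n ^ k * m ^ M * K !    ≡⟨ *-assoc (n ^ k) (m ^ M) (K !) ⟩
  n ^ k * (m ^ M * K !)  ≡⟨ x∙yz≈y∙xz (n ^ k) (m ^ M) (K !) ⟩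
  m ^ M * (n ^ k * K !)  ∎)
  where
  open NegativeBinomial m
  open ≤-Reasoning
  M : ℕ
  M = a * k
  mᴹ≢0 : NonZero (m ^ M)
  mᴹ≢0 = subst NonZero (^-*-assoc m a k) (m^n≢0 (m ^ a) k {{mᵃ≢0}})
    where
    mᵃ≢0 : NonZero (m ^ a)
    mᵃ≢0 = m*n≢0⇒n≢0 n {{>-nonZero (<-≤-trans (m^n>0 k a) ratio)}}
  scaled : k ^ K * (m ^ M * expScaled a K) ≤ k ^ K * (k ^ M * K !)
  scaled = begin
    k ^ K * (m ^ M * expScaled a K)  ≡⟨ x∙yz≈y∙xz (k ^ K) (m ^ M) _ ⟩
    m ^ M * (k ^ K * expScaled a K)  ≤⟨ *-monoʳ-≤ (m ^ M) (expScaled≤series a K) ⟩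
    m ^ M * series M K               ≤⟨ series-bound M K ⟩
    k ^ (M + K) * K !                ≡⟨ cong (_* K !) (^-distribˡ-+-* k M K) ⟩
    k ^ M * k ^ K * K !              ≡⟨ *-assoc (k ^ M) (k ^ K) (K !) ⟩
    k ^ M * (k ^ K * K !)            ≡⟨ x∙yz≈y∙xz (k ^ M) (k ^ K) (K !) ⟩
    k ^ K * (k ^ M * K !)            ∎
  kᴹ≤nᵏmᴹ : k ^ M ≤ n ^ k * m ^ M
  kᴹ≤nᵏmᴹ = begin
    k ^ M                ≡⟨ ^-*-assoc k a k ⟨
    (k ^ a) ^ k          ≤⟨ ^-monoˡ-≤ k ratio ⟩
    (n * m ^ a) ^ k      ≡⟨ ^-distribʳ-* n (m ^ a) k ⟩
    n ^ k * (m ^ a) ^ k  ≡⟨ cong (n ^ k *_) (^-*-assoc m a k) ⟩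
    n ^ k * m ^ M        ∎

last-before-failure : ∀ {p} {P : Pred ℕ p} → Decidable P → P 0 → ∀ B → ¬ P B →
                      ∃ λ a → P a × ¬ P (suc a)
last-before-failure P? P0 zero    ¬P0 = contradiction P0 ¬P0
last-before-failure P? P0 (suc B) ¬PB with P? B
... | yes PB = B , PB , ¬PB
... | no ¬PB = last-before-failure P? P0 B ¬PB

bernoulli : ∀ m j → m ^ j * (m + j) ≤ m * suc m ^ j
bernoulli m zero    = ≤-reflexive (unit m)
  where
  unit : ∀ m → 1 * (m + 0) ≡ m * 1
  unit = solve-∀
bernoulli m (suc j) = begin
  m * m ^ j * (m + suc j)                  ≡⟨ expand m (m ^ j) j ⟩
  m * (m ^ j * (m + j)) + m ^ j * m        ≤⟨ +-monoʳ-≤ _ (*-monoʳ-≤ (m ^ j) (m≤m+n m j)) ⟩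
  m * (m ^ j * (m + j)) + m ^ j * (m + j)  ≡⟨ +-comm _ (m ^ j * (m + j)) ⟩
  suc m * (m ^ j * (m + j))                ≤⟨ *-monoʳ-≤ (suc m) (bernoulli m j) ⟩
  suc m * (m * suc m ^ j)                  ≡⟨ x∙yz≈y∙xz (suc m) m _ ⟩
  m * (suc m * suc m ^ j)                  ∎
  where
  open ≤-Reasoning
  expand : ∀ m p j → m * p * (m + suc j) ≡ m * (p * (m + j)) + p * m
  expand = solve-∀

ratio-unbounded : ∀ m n → ∃ λ B → ¬ (suc m ^ B ≤ n * m ^ B)
ratio-unbounded zero    n = 1 , λ 1≤n*0 → contradiction (≤-trans 1≤n*0 (≤-reflexive (*-zeroʳ n))) λ ()
ratio-unbounded (suc m) n = j , λ ratio → <⇒≱ (m<n+m j {μ} z<s) (*-cancelˡ-≤ (μ ^ j) {{m^n≢0 μ j}} (begin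
  μ ^ j * (μ + j)  ≤⟨ bernoulli μ j ⟩
  μ * suc μ ^ j    ≤⟨ *-monoʳ-≤ μ ratio ⟩
  μ * (n * μ ^ j)  ≡⟨ rearrange μ n (μ ^ j) ⟩
  μ ^ j * j        ∎))
  where
  open ≤-Reasoning
  μ j : ℕ
  μ = suc m
  j = n * μ
  rearrange : ∀ μ n q → μ * (n * q) ≡ q * (n * μ)
  rearrange = solve-∀

unique-⊆⇒length≤ : ∀ {S T : List A} → Unique S → (∀ {z} → z ∈ S → z ∈ T) →
                   length S ≤ length T
unique-⊆⇒length≤ {S = []}    _            _   = z≤n
unique-⊆⇒length≤ {S = x ∷ S} (x∉S ∷ uniq) S⊆T with ∈-∃++ (S⊆T (here refl))
... | T₁ , T₂ , refl = begin
  suc (length S)                 ≤⟨ s≤s (unique-⊆⇒length≤ uniq S⊆T₁++T₂) ⟩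
  suc (length (T₁ ++ T₂))        ≡⟨ cong suc (length-++ T₁) ⟩
  suc (length T₁ + length T₂)    ≡⟨ +-suc (length T₁) (length T₂) ⟨
  length T₁ + length (x ∷ T₂)    ≡⟨ length-++ T₁ ⟨
  length (T₁ ++ x ∷ T₂)          ∎
  where
  open ≤-Reasoning
  S⊆T₁++T₂ : ∀ {z} → z ∈ S → z ∈ T₁ ++ T₂
  S⊆T₁++T₂ z∈S with ∈-++⁻ T₁ (S⊆T (there z∈S))
  ... | inj₁ z∈T₁         = ∈-++⁺ˡ z∈T₁
  ... | inj₂ (here refl)  = contradiction refl (All.lookup x∉S z∈S)
  ... | inj₂ (there z∈T₂) = ∈-++⁺ʳ T₁ z∈T₂

sum-map-+ : ∀ (f g : A → ℕ) xs →
            sum (map (λ x → f x + g x) xs) ≡ sum (map f xs) + sum (map g xs)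
sum-map-+ f g []       = refl
sum-map-+ f g (x ∷ xs) = trans (cong (f x + g x +_) (sum-map-+ f g xs))
                               (+-interchange (f x) (g x) _ _)

sum-map-const : ∀ c (xs : List A) → sum (map (λ _ → c) xs) ≡ length xs * c
sum-map-const c []       = refl
sum-map-const c (x ∷ xs) = cong (c +_) (sum-map-const c xs)

sum-map-mono : ∀ {f g : A → ℕ} {xs} → All (λ x → f x ≤ g x) xs →
               sum (map f xs) ≤ sum (map g xs)
sum-map-mono []           = z≤n
sum-map-mono (fx≤gx ∷ le) = +-mono-≤ fx≤gx (sum-map-mono le)

sum-map-*-≤ : ∀ {f : A → ℕ} {c b} xs → All (λ x → f x * c ≤ b) xs →
              sum (map f xs) * c ≤ length xs * b
sum-map-*-≤ []       []                                 = z≤n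
sum-map-*-≤ {f = f} {c} {b} (x ∷ xs) (le ∷ les) = begin
  (f x + sum (map f xs)) * c     ≡⟨ *-distribʳ-+ c (f x) _ ⟩
  f x * c + sum (map f xs) * c   ≤⟨ +-mono-≤ le (sum-map-*-≤ xs les) ⟩
  b + length xs * b              ∎
  where open ≤-Reasoning

sum-map-comm : ∀ (h : A → B → ℕ) xs ys →
               sum (map (λ x → sum (map (h x) ys)) xs) ≡ sum (map (λ y → sum (map (λ x → h x y) xs)) ys)
sum-map-comm h []       ys = sym (trans (sum-map-const 0 ys) (*-zeroʳ (length ys)))
sum-map-comm h (x ∷ xs) ys = begin
  sum (map (h x) ys) + sum (map (λ x → sum (map (h x) ys)) xs)
    ≡⟨ cong (sum (map (h x) ys) +_) (sum-map-comm h xs ys) ⟩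
  sum (map (h x) ys) + sum (map (λ y → sum (map (λ x → h x y) xs)) ys)
    ≡⟨ sum-map-+ (h x) (λ y → sum (map (λ x → h x y) xs)) ys ⟨
  sum (map (λ y → h x y + sum (map (λ x → h x y) xs)) ys) ∎
  where open ≡-Reasoning

sum-map-filter : ∀ {P : A → Set} (P? : Decidable P) (f : A → ℕ) xs →
                 sum (map f (filter (∁? P?) xs)) ≡ sum (map (λ x → if does (P? x) then 0 else f x) xs)
sum-map-filter P? f []       = refl
sum-map-filter P? f (x ∷ xs) with P? x
... | yes _ = sum-map-filter P? f xs
... | no  _ = cong (f x +_) (sum-map-filter P? f xs)

min≤average : ∀ (g : A → ℕ) xs → 0 < length xs → ∃ λ y → y ∈ xs × length xs * g y ≤ sum (map g xs)
min≤average {A = A} g (x ∷ xs) _ = y , argmin-all g (here refl) (All.tabulate there) , y≤average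
  where
  open ≤-Reasoning
  y : A
  y = argmin g x xs
  y≤average : length (x ∷ xs) * g y ≤ sum (map g (x ∷ xs))
  y≤average = begin
    length (x ∷ xs) * g y           ≡⟨ sum-map-const (g y) (x ∷ xs) ⟨
    sum (map (λ _ → g y) (x ∷ xs))  ≤⟨ sum-map-mono (f[argmin]≤f[⊤] {f = g} x xs ∷ f[argmin]≤f[xs] x xs) ⟩
    sum (map g (x ∷ xs))            ∎

if-then-0-≤ : ∀ b x → (if b then 0 else x) ≤ x
if-then-0-≤ true  x = z≤n
if-then-0-≤ false x = ≤-refl

sum-map-skip : ∀ (f : ℕ → ℕ) {t ys} → t ∈ ys →
               f t + sum (map (λ y → if does (t ≟ y) then 0 else f y) ys) ≤ sum (map f ys)
sum-map-skip f {t} {_ ∷ ys} (here refl) rewrite dec-true (t ≟ t) refl =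
  +-monoʳ-≤ (f t) (sum-map-mono (All.universal (λ y → if-then-0-≤ (does (t ≟ y)) (f y)) ys))
sum-map-skip f {t} {y ∷ ys} (there t∈ys) = begin
  f t + (skipped y + sum (map skipped ys))  ≡⟨ +-exchange (f t) (skipped y) _ ⟩
  skipped y + (f t + sum (map skipped ys))  ≤⟨ +-mono-≤ (if-then-0-≤ (does (t ≟ y)) (f y)) (sum-map-skip f t∈ys) ⟩
  f y + sum (map f ys)                      ∎
  where
  open ≤-Reasoning
  skipped : ℕ → ℕ
  skipped y = if does (t ≟ y) then 0 else f y

module Derandomization (m : ℕ) where

  k : ℕ
  k = suc m

  Demand : Set
  Demand = ℕ × List ℕ

  Meets : (ℕ → ℕ) → List ℕ → Demand → Set
  Meets f U (t , S) = ∃ λ z → z ∈ S × z ∈ U × f z ≡ t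

  -- The number of maps from U to a palette of k colors that miss a demand (t , S) with t
  -- in the palette: an element of S has m admissible colors, any other element k.
  missWeight : List ℕ → List ℕ → ℕ
  missWeight []      S = 1
  missWeight (x ∷ U) S = (if does (x ∈? S) then m else k) * missWeight U S

  potential : List ℕ → List Demand → ℕ
  potential U ds = sum (map (missWeight U ∘ proj₂) ds)

  HitAt : ℕ → ℕ → Demand → Set
  HitAt x y (t , S) = x ∈ S × t ≡ y

  hitAt? : ∀ x y → Decidable (HitAt x y)
  hitAt? x y (t , S) = (x ∈? S) ×-dec (t ≟ y)

  unmet : ℕ → ℕ → List Demand → List Demand
  unmet x y = filter (∁? (hitAt? x y))

  module _ {Ys : List ℕ} (|Ys|≡k : length Ys ≡ k) where

    sum-missWeight-unmet : ∀ x U {t S} → t ∈ Ys →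
      sum (map (λ y → if does (hitAt? x y (t , S)) then 0 else missWeight U S) Ys) ≤ missWeight (x ∷ U) S
    sum-missWeight-unmet x U {t} {S} t∈Ys with x ∈? S
    ... | yes _ = +-cancelˡ-≤ w _ _ (begin
      w + sum (map (λ y → if does (t ≟ y) then 0 else w) Ys) ≤⟨ sum-map-skip (λ _ → w) t∈Ys ⟩
      sum (map (λ _ → w) Ys)                                 ≡⟨ sum-map-const w Ys ⟩
      length Ys * w                                          ≡⟨ cong (_* w) |Ys|≡k ⟩
      w + m * w                                              ∎)
      where
      open ≤-Reasoning
      w : ℕ
      w = missWeight U S
    ... | no  _ = ≤-reflexive (trans (sum-map-const _ Ys) (cong (_* missWeight U S) |Ys|≡k))

    sum-potential-unmet : ∀ x U ds → All (λ d → proj₁ d ∈ Ys) ds →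
      sum (map (λ y → potential U (unmet x y ds)) Ys) ≤ potential (x ∷ U) ds
    sum-potential-unmet x U ds targets = begin
      sum (map (λ y → potential U (unmet x y ds)) Ys)
        ≡⟨ cong sum (map-cong (λ y → sum-map-filter (hitAt? x y) (missWeight U ∘ proj₂) ds) Ys) ⟩
      sum (map (λ y → sum (map (missed y) ds)) Ys)
        ≡⟨ sum-map-comm missed Ys ds ⟩
      sum (map (λ d → sum (map (λ y → missed y d) Ys)) ds)
        ≤⟨ sum-map-mono (All.map (sum-missWeight-unmet x U) targets) ⟩
      potential (x ∷ U) ds ∎
      where
      open ≤-Reasoning
      missed : ℕ → Demand → ℕ
      missed y d = if does (hitAt? x y d) then 0 else missWeight U (proj₂ d)

    -- potential U ds / k ^ length U is the expected number of demands missed by a random map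
    -- U → Ys; x receives the color y that minimises this expectation for the remaining demands.
    meets-all : ∀ U → Unique U → ∀ ds → All (λ d → proj₁ d ∈ Ys) ds →
                potential U ds < k ^ length U → ∃ λ f → All (Meets f U) ds
    meets-all []      _            []       _       _         = (λ _ → 0) , []
    meets-all []      _            (_ ∷ _)  _       (s≤s ())
    meets-all (x ∷ U) (x∉U ∷ uniq) ds       targets potential< = f , All.tabulate meets
      where
      open ≤-Reasoning
      remaining : ℕ → ℕ
      remaining y = potential U (unmet x y ds)
      best : ∃ λ y → y ∈ Ys × length Ys * remaining y ≤ sum (map remaining Ys)
      best = min≤average remaining Ys (subst (0 <_) (sym |Ys|≡k) z<s)
      y : ℕ
      y = proj₁ best
      remaining< : remaining y < k ^ length U
      remaining< = *-cancelˡ-< k _ _ (begin-strict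
        k * remaining y                   ≡⟨ cong (_* remaining y) |Ys|≡k ⟨
        length Ys * remaining y           ≤⟨ proj₂ (proj₂ best) ⟩
        sum (map remaining Ys)            ≤⟨ sum-potential-unmet x U ds targets ⟩
        potential (x ∷ U) ds              <⟨ potential< ⟩
        k * k ^ length U                  ∎)
      rest : ∃ λ f′ → All (Meets f′ U) (unmet x y ds)
      rest = meets-all U uniq (unmet x y ds) (All.filter⁺ (∁? (hitAt? x y)) targets) remaining<
      f′ : ℕ → ℕ
      f′ = proj₁ rest
      f : ℕ → ℕ
      f z = if does (z ≟ x) then y else f′ z
      f-x : f x ≡ y
      f-x rewrite dec-true (x ≟ x) refl = refl
      f-other : ∀ {z} → z ≢ x → f z ≡ f′ z
      f-other {z} z≢x rewrite dec-false (z ≟ x) z≢x = refl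
      meets : ∀ {d} → d ∈ ds → Meets f (x ∷ U) d
      meets {t , S} d∈ds with hitAt? x y (t , S)
      ... | yes (x∈S , t≡y) = x , x∈S , here refl , trans f-x (sym t≡y)
      ... | no  ¬hit with All.lookup (proj₂ rest) (∈-filter⁺ (∁? (hitAt? x y)) d∈ds ¬hit)
      ...   | z , z∈S , z∈U , f′z≡t = z , z∈S , there z∈U , trans (f-other z≢x) f′z≡t
        where
        z≢x : z ≢ x
        z≢x z≡x = All.lookup x∉U z∈U (sym z≡x)

  missWeight-exact : ∀ U S → let c = length (filter (_∈? S) U) in
                     missWeight U S * k ^ c ≡ m ^ c * k ^ length U
  missWeight-exact []      S = refl
  missWeight-exact (x ∷ U) S with x ∈? S
  ... | yes _ = begin
    m * w * (k * k ^ c)      ≡⟨ interchange m w k (k ^ c) ⟩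
    m * k * (w * k ^ c)      ≡⟨ cong (m * k *_) (missWeight-exact U S) ⟩
    m * k * (m ^ c * k ^ u)  ≡⟨ interchange m k (m ^ c) (k ^ u) ⟩
    m * m ^ c * (k * k ^ u)  ∎
    where
    open ≡-Reasoning
    w c u : ℕ
    w = missWeight U S
    c = length (filter (_∈? S) U)
    u = length U
  ... | no  _ = begin
    k * w * k ^ c        ≡⟨ *-assoc k w (k ^ c) ⟩
    k * (w * k ^ c)      ≡⟨ cong (k *_) (missWeight-exact U S) ⟩
    k * (m ^ c * k ^ u)  ≡⟨ x∙yz≈y∙xz k (m ^ c) (k ^ u) ⟩
    m ^ c * (k * k ^ u)  ∎
    where
    open ≡-Reasoning
    w c u : ℕ
    w = missWeight U S
    c = length (filter (_∈? S) U)
    u = length U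

  missWeight-bound : ∀ U {S j} → Unique S → (∀ {z} → z ∈ S → z ∈ U) → j ≤ length S →
                     missWeight U S * k ^ j ≤ m ^ j * k ^ length U
  missWeight-bound U {S} {j} uniq S⊆U j≤|S| = *-cancelˡ-≤ (k ^ c) {{m^n≢0 k c}} (begin
    k ^ c * (w * k ^ j)      ≡⟨ x∙yz≈y∙xz (k ^ c) w (k ^ j) ⟩
    w * (k ^ c * k ^ j)      ≡⟨ *-assoc w (k ^ c) (k ^ j) ⟨
    w * k ^ c * k ^ j        ≡⟨ cong (_* k ^ j) (missWeight-exact U S) ⟩
    m ^ c * k ^ u * k ^ j    ≡⟨ xy∙z≈xz∙y (m ^ c) (k ^ u) (k ^ j) ⟩
    m ^ c * k ^ j * k ^ u    ≤⟨ *-monoˡ-≤ (k ^ u) (^-ratio-antitone (n≤1+n m) j≤c) ⟩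
    m ^ j * k ^ c * k ^ u    ≡⟨ cong (_* k ^ u) (*-comm (m ^ j) (k ^ c)) ⟩
    k ^ c * m ^ j * k ^ u    ≡⟨ *-assoc (k ^ c) (m ^ j) (k ^ u) ⟩
    k ^ c * (m ^ j * k ^ u)  ∎)
    where
    open ≤-Reasoning
    w c u : ℕ
    w = missWeight U S
    c = length (filter (_∈? S) U)
    u = length U
    j≤c : j ≤ c
    j≤c = ≤-trans j≤|S| (unique-⊆⇒length≤ uniq (λ z∈S → ∈-filter⁺ (_∈? S) (S⊆U z∈S) z∈S))

  hitting-map : ∀ {Ys : List ℕ} → length Ys ≡ k → ∀ {n b} {c : Fin n → ℕ} {L : Fin n → List ℕ} →
                (∀ v → c v ∈ Ys) → (∀ v → Unique (L v)) → (∀ v → b ≤ length (L v)) →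
                n * m ^ b < k ^ b → ∃ λ f → ∀ v → ∃ λ z → z ∈ L v × f z ≡ c v
  hitting-map |Ys|≡k {n} {b} {c} {L} c∈Ys uniqL b≤|L| ratio = f , hit
    where
    U : List ℕ
    U = deduplicate _≟_ (concat (tabulate L))
    L⊆U : ∀ {v z} → z ∈ L v → z ∈ U
    L⊆U {v} z∈Lv = ∈-deduplicate⁺ _≟_ (∈-concat⁺′ z∈Lv (∈-tabulate⁺ v))
    ds : List Demand
    ds = tabulate (λ v → c v , L v)
    potential< : potential U ds < k ^ length U
    potential< = *-cancelˡ-< (k ^ b) _ _ (begin-strict
      k ^ b * potential U ds       ≡⟨ *-comm (k ^ b) _ ⟩
      potential U ds * k ^ b       ≤⟨ sum-map-*-≤ ds (All.tabulate⁺ λ v → missWeight-bound U (uniqL v) L⊆U (b≤|L| v)) ⟩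
      length ds * (m ^ b * k ^ u)  ≡⟨ cong (_* (m ^ b * k ^ u)) (length-tabulate (λ v → c v , L v)) ⟩
      n * (m ^ b * k ^ u)          ≡⟨ *-assoc n (m ^ b) (k ^ u) ⟨
      n * m ^ b * k ^ u            <⟨ *-monoˡ-< (k ^ u) {{m^n≢0 k u}} ratio ⟩
      k ^ b * k ^ u                ∎)
      where
      open ≤-Reasoning
      u : ℕ
      u = length U
    found : ∃ λ f → All (Meets f U) ds
    found = meets-all |Ys|≡k U (deduplicate-! _) ds (All.tabulate⁺ c∈Ys) potential<
    f : ℕ → ℕ
    f = proj₁ found
    hit : ∀ v → ∃ λ z → z ∈ L v × f z ≡ c v
    hit v with z , z∈L , _ , fz≡c ← All.lookup (proj₂ found) (∈-tabulate⁺ v) = z , z∈L , fz≡c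

factors-through⇒isRefinement : ∀ {n} {c c′ : Coloring n} (f : ℕ → ℕ) →
                               (∀ v → f (c′ v) ≡ c v) → IsRefinement c c′
factors-through⇒isRefinement f fc′≡c x y cx≢cy c′x≡c′y =
  cx≢cy (trans (sym (fc′≡c x)) (trans (cong f c′x≡c′y) (fc′≡c y)))

refinement-from-lists : ∀ {𝒞 : ColoringClass} {n} {H : Hypergraph n} {c : Coloring n} →
  RefinementProperty 𝒞 → IsCColoring 𝒞 H c → (L : Fin n → List ℕ) →
  ((v : Fin n) (x : ℕ) → x ∈ L v → 0 < x) → (f : ℕ → ℕ) →
  (∀ v → ∃ λ z → z ∈ L v × f z ≡ c v) →
  ∃ λ c′ → IsCColoring 𝒞 H c′ × ((v : Fin n) → c′ v ∈ L v)
refinement-from-lists {H = H} {c} refines c-col L posL f hit =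
  c′ , refines H c c′ c-col (λ v → posL v (c′ v) (c′∈L v)) (factors-through⇒isRefinement f fc′≡c) , c′∈L
  where
  c′ : Coloring _
  c′ v = proj₁ (hit v)
  c′∈L : ∀ v → c′ v ∈ L v
  c′∈L v = proj₁ (proj₂ (hit v))
  fc′≡c : ∀ v → f (c′ v) ≡ c v
  fc′≡c v = proj₂ (proj₂ (hit v))

pad-to-length : ∀ {k} (cs : List ℕ) → length cs ≤ k →
                ∃ λ Ys → length Ys ≡ k × (∀ {x} → x ∈ cs → x ∈ Ys)
pad-to-length {k} cs |cs|≤k = cs ++ replicate (k ∸ length cs) 0 , |padded|≡k , ∈-++⁺ˡ
  where
  open ≡-Reasoning
  |padded|≡k : length (cs ++ replicate (k ∸ length cs) 0) ≡ k
  |padded|≡k = begin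
    length (cs ++ replicate (k ∸ length cs) 0)        ≡⟨ length-++ cs ⟩
    length cs + length (replicate (k ∸ length cs) 0)  ≡⟨ cong (length cs +_) (length-replicate (k ∸ length cs)) ⟩
    length cs + (k ∸ length cs)                       ≡⟨ m+[n∸m]≡n |cs|≤k ⟩
    k                                                 ∎

listColorable : ∀ {𝒞 : ColoringClass} {n} {H : Hypergraph n} {c : Coloring n} {m b} →
                RefinementProperty 𝒞 → IsCColoring 𝒞 H c → UsesAtMostColors c (suc m) →
                n * m ^ b < suc m ^ b → ListColorable 𝒞 H b
listColorable {m = m} refines c-col (cs , |cs|≤k , c∈cs) ratio L uniqL b≤|L| posL
  with palette , |palette|≡k , cs⊆palette ← pad-to-length cs |cs|≤k
  with f , hit ← Derandomization.hitting-map m |palette|≡k (cs⊆palette ∘ c∈cs) uniqL b≤|L| ratio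
  = refinement-from-lists refines c-col L posL f hit

no-colors : ∀ {n} {c : Coloring n} → 1 ≤ n → ¬ UsesAtMostColors c 0
no-colors (s≤s z≤n) ([]    , _  , c∈[]) = contradiction (c∈[] zero) λ ()
no-colors (s≤s z≤n) (_ ∷ _ , () , _)

mainTheorem14 : (𝒞 : ColoringClass) → RefinementProperty 𝒞 →
    (n : ℕ) → 1 ≤ n → (H : Hypergraph n) → (k : ℕ) →
    ChromaticAtMost 𝒞 H k →
    Σ ℕ λ a → ExpLe a (n ^ k) × ListColorable 𝒞 H (suc a)
mainTheorem14 𝒞 refines n 1≤n H zero    (c , _ , colors) = contradiction colors (no-colors 1≤n)
mainTheorem14 𝒞 refines n 1≤n H (suc m) (c , c-col , colors)
  with B , ratio≰n ← ratio-unbounded m n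
  with a , ratio≤n , next-ratio≰n ← last-before-failure (λ a → suc m ^ a ≤? n * m ^ a)
                                      (subst (1 ≤_) (sym (*-identityʳ n)) 1≤n) B ratio≰n
  = a , expLe-from-ratio m n a ratio≤n , listColorable refines c-col colors (≰⇒> next-ratio≰n)
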